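{- Let $A$ be a non-empty set, $I$ a non-empty index set, $\mathcal{A}=(A,I,V_i)$ a fuzzy relational system, $E$ a fuzzy equivalence on $A$, and $\mathcal{A}/E=(A/E,I,V_i^{A/E})$ the quotient fuzzy relational system. Let $E^\natural\in\mathcal{R}(A,A/E)$ be given by $E^\natural(a_1,E_{a_2})=E(a_1,a_2)$. The following conditions are equivalent: (i) $E$ is a solution to $WL^{1\text{ - }4}(A,I,V_i)$, i.e. $E\circ V_i\le V_i\circ E$ and $E^{ -1}\circ V_i\le V_i\circ E^{ -1}$ for all $i\in I$; (ii) $E^\natural$ is a solution to $WL^{2\text{ - }3}(A,A/E,I,V_i,V_i^{A/E})$, i.e. $(E^\natural)^{ -1}\circ V_i\le V_i^{A/E}\circ(E^\natural)^{ -1}$ and $E^\natural\circ V_i^{A/E}\le V_i\circ E^\natural$ for all $i\in I$; (iii) $E^\natural$ is a solution to $WL^{2\text{ - }5}(A,A/E,I,V_i,V_i^{A/E})$, i.e. $V_i\circ E^\natural=E^\natural\circ V_i^{A/E}$ for all $i\in I$.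
   Context: $\mathcal{L}=(L,\wedge,\vee,\otimes,\to,0,1)$ is a complete residuated lattice. $\mathcal{R}(A,B)$: fuzzy relations $A\times B\to L$ ordered pointwise; $\mathcal{R}(A)=\mathcal{R}(A,A)$; $R^{ -1}(b,a)=R(a,b)$; $(R\circ S)(a,c)=\bigvee_b R(a,b)\otimes S(b,c)$. A fuzzy equivalence on $A$ is $E\in\mathcal{R}(A)$ that is reflexive ($E(a,a)=1$), symmetric and transitive ($E(a,b)\otimes E(b,c)\le E(a,c)$). $E_a$ denotes the fuzzy set $x\mapsto E(a,x)$ and $A/E=\{E_a:a\in A\}$. A fuzzy relational system is $\mathcal{A}=(A,I,V_i)$ with $V_i\in\mathcal{R}(A)$; its quotient is $\mathcal{A}/E=(A/E,I,V_i^{A/E})$ with $V_i^{A/E}(E_{a_1},E_{a_2})=(E\circ V_i\circ E)(a_1,a_2)$ (well defined). -}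

module Defs where

open import Level using (Level; _⊔_) renaming (suc to lsuc)
open import Data.Product using (_×_; ∃)
open import Function using (_⇔_)
open import Relation.Binary.Core using (Rel)
open import Relation.Binary.Structures using (IsPartialOrder)
open import Relation.Binary.Definitions using (Maximum; Minimum)
open import Relation.Binary.Lattice.Definitions using (Supremum; Infimum)
open import Algebra.Structures using (IsCommutativeMonoid)

record CompleteResiduatedLattice (c ℓ i : Level) : Set (lsuc (c ⊔ ℓ ⊔ i)) where
  infixr 6 _⊗_
  infix 4 _≈_ _≤_
  field
    Carrier        : Set c
    _≈_            : Rel Carrier ℓ
    _≤_            : Rel Carrier ℓ
    isPartialOrder : IsPartialOrder _≈_ _≤_
    _∧_ _∨_        : Carrier → Carrier → Carrier
    ∧-infimum      : Infimum _≤_ _∧_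
    ∨-supremum     : Supremum _≤_ _∨_
    0L 1L          : Carrier
    0-minimum      : Minimum _≤_ 0L
    1-maximum      : Maximum _≤_ 1L
    ⋁              : {J : Set i} → (J → Carrier) → Carrier
    ⋁-upper        : {J : Set i} (f : J → Carrier) (j : J) → f j ≤ ⋁ f
    ⋁-least        : {J : Set i} (f : J → Carrier) (x : Carrier) → (∀ j → f j ≤ x) → ⋁ f ≤ x
    ⋀              : {J : Set i} → (J → Carrier) → Carrier
    ⋀-lower        : {J : Set i} (f : J → Carrier) (j : J) → ⋀ f ≤ f j
    ⋀-greatest     : {J : Set i} (f : J → Carrier) (x : Carrier) → (∀ j → x ≤ f j) → x ≤ ⋀ f
    _⊗_            : Carrier → Carrier → Carrier
    ⊗-isCommutativeMonoid : IsCommutativeMonoid _≈_ _⊗_ 1L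
    _⇒_            : Carrier → Carrier → Carrier
    residuation    : ∀ x y z → (x ⊗ y ≤ z) ⇔ (x ≤ y ⇒ z)

module FuzzyRelations {c ℓ i : Level} (L : CompleteResiduatedLattice c ℓ i) where
  open CompleteResiduatedLattice L

  FRel : Set i → Set i → Set (i ⊔ c)
  FRel A B = A → B → Carrier

  _⁻¹ : {A B : Set i} → FRel A B → FRel B A
  (R ⁻¹) b a = R a b

  infixl 7 _∘_
  _∘_ : {A B C : Set i} → FRel A B → FRel B C → FRel A C
  (R ∘ S) a c′ = ⋁ (λ b → R a b ⊗ S b c′)

  infix 4 _⊆_ _≐_
  _⊆_ : {A B : Set i} → FRel A B → FRel A B → Set (i ⊔ ℓ)
  R ⊆ S = ∀ a b → R a b ≤ S a b

  _≐_ : {A B : Set i} → FRel A B → FRel A B → Set (i ⊔ ℓ)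
  R ≐ S = ∀ a b → R a b ≈ S a b

  record IsFuzzyEquivalence {A : Set i} (E : FRel A A) : Set (i ⊔ ℓ) where
    field
      reflexive  : ∀ a → E a a ≈ 1L
      symmetric  : ∀ a b → E a b ≈ E b a
      transitive : ∀ a b c′ → E a b ⊗ E b c′ ≤ E a c′

  -- The quotient set A/E = {E_a : a ∈ A}: an element is the class E_a, presented
  -- by a representative a.  Two presentations denote the same class E_a = E_b
  -- iff E a b ≈ 1 (equivalently, ∀ x, E a x ≈ E b x); all relations on A/E
  -- used below are well defined, i.e. invariant under change of representative.
  record Quot {A : Set i} (E : FRel A A) : Set i where
    constructor [_]
    field rep : A
  open Quot public

  class : {A : Set i} (E : FRel A A) → Quot E → A → Carrier
  class E q x = E (rep q) x

  quotRel : {A : Set i} (E : FRel A A) → FRel A A → FRel (Quot E) (Quot E)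
  quotRel E V q₁ q₂ = (E ∘ V ∘ E) (rep q₁) (rep q₂)

  natural : {A : Set i} (E : FRel A A) → FRel A (Quot E)
  natural E a q = E a (rep q)

  WL14 : {A : Set i} {I : Set i} (V : I → FRel A A) (E : FRel A A) → Set (i ⊔ ℓ)
  WL14 V E = ∀ j → (E ∘ V j ⊆ V j ∘ E) × (E ⁻¹ ∘ V j ⊆ V j ∘ E ⁻¹)

  WL23 : {A B : Set i} {I : Set i} (V : I → FRel A A) (W : I → FRel B B) (R : FRel A B) → Set (i ⊔ ℓ)
  WL23 V W R = ∀ j → (R ⁻¹ ∘ V j ⊆ W j ∘ R ⁻¹) × (R ∘ W j ⊆ V j ∘ R)

  WL25 : {A B : Set i} {I : Set i} (V : I → FRel A A) (W : I → FRel B B) (R : FRel A B) → Set (i ⊔ ℓ)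
  WL25 V W R = ∀ j → V j ∘ R ≐ R ∘ W j

module Submission where

-- Write Ṽ = E ∘ V ∘ E for the saturation of V by E; the
-- quotient relation is V^{A/E}(E_a , E_b) = Ṽ(a , b).  Everything about the
-- natural relation E♮ reduces to statements on A:
--   (V ∘ E♮)(a , E_b) = (V ∘ E)(a , b)        (by definition),
--   (E♮ ∘ V^{A/E})(a , E_b) = (E ∘ Ṽ)(a , b) = Ṽ(a , b),
-- the last step because a join over A/E is a join over representatives and
-- E ∘ Ṽ = Ṽ.  Hence, for each index i,
--   (i)   says E ∘ V ≤ V ∘ E (the E⁻¹ half follows, as E⁻¹ = E),
--   (ii)  says Ṽ ≤ V ∘ E (its other half holds for every V),
--   (iii) says V ∘ E = Ṽ,
-- and the three are equivalent because V ∘ E ≤ Ṽ always, while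
-- E ∘ V ≤ V ∘ E gives Ṽ ≤ V ∘ E ∘ E ≤ V ∘ E.

open import Defs
open import Level using (Level)
open import Data.Product using (_×_; _,_; proj₁; proj₂)
open import Function using (_⇔_; mk⇔; Equivalence)
open import Function.Construct.Composition using (_⇔-∘_)
open import Function.Construct.Symmetry using (⇔-sym)
open import Relation.Binary.Bundles using (Poset)
open import Relation.Binary.Structures using (IsPartialOrder)
open import Relation.Binary.PropositionalEquality using (_≡_; refl; cong; sym)
open import Algebra.Structures using (IsCommutativeMonoid)
import Relation.Binary.Reasoning.PartialOrder as PosetReasoning

∀-⇔ : ∀ {a p q} {J : Set a} {P : J → Set p} {Q : J → Set q}
    → (∀ j → P j ⇔ Q j) → ((∀ j → P j) ⇔ (∀ j → Q j))
∀-⇔ e = mk⇔ (λ p j → Equivalence.to (e j) (p j)) (λ q j → Equivalence.from (e j) (q j))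

module LatticeFacts {c ℓ i : Level} (L : CompleteResiduatedLattice c ℓ i) where
  open CompleteResiduatedLattice L
  open IsPartialOrder isPartialOrder public
    using (antisym; module Eq) renaming (refl to ≤-refl; trans to ≤-trans; reflexive to ≤-reflexive)
  open IsCommutativeMonoid ⊗-isCommutativeMonoid using (comm; identityˡ; identityʳ)

  poset : Poset c ℓ ℓ
  poset = record { isPartialOrder = isPartialOrder }

  open PosetReasoning poset

  -- _⊗ z is monotone, being left adjoint to z ⇒_.
  ⊗-monoˡ : ∀ {x y} z → x ≤ y → x ⊗ z ≤ y ⊗ z
  ⊗-monoˡ {x} {y} z x≤y =
    Equivalence.from (residuation x z (y ⊗ z))
      (≤-trans x≤y (Equivalence.to (residuation y z (y ⊗ z)) ≤-refl))

  ⊗-monoʳ : ∀ {x y} z → x ≤ y → z ⊗ x ≤ z ⊗ y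
  ⊗-monoʳ {x} {y} z x≤y = begin
    z ⊗ x  ≈⟨ comm z x ⟩
    x ⊗ z  ≤⟨ ⊗-monoˡ z x≤y ⟩
    y ⊗ z  ≈⟨ comm y z ⟩
    z ⊗ y  ∎

  ⊗-mono : ∀ {x y u v} → x ≤ y → u ≤ v → x ⊗ u ≤ y ⊗ v
  ⊗-mono {y = y} {u = u} x≤y u≤v = ≤-trans (⊗-monoˡ u x≤y) (⊗-monoʳ y u≤v)

  ⊗-inflateʳ : ∀ {e} x → 1L ≤ e → x ≤ x ⊗ e
  ⊗-inflateʳ {e} x 1≤e = begin
    x       ≈⟨ identityʳ x ⟨
    x ⊗ 1L  ≤⟨ ⊗-monoʳ x 1≤e ⟩
    x ⊗ e   ∎

  ⊗-inflateˡ : ∀ {e} x → 1L ≤ e → x ≤ e ⊗ x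
  ⊗-inflateˡ {e} x 1≤e = begin
    x       ≈⟨ identityˡ x ⟨
    1L ⊗ x  ≤⟨ ⊗-monoˡ x 1≤e ⟩
    e ⊗ x   ∎

  ≤-⋁ : ∀ {J : Set i} (f : J → Carrier) j {x} → x ≤ f j → x ≤ ⋁ f
  ≤-⋁ f j x≤fj = ≤-trans x≤fj (⋁-upper f j)

  -- ⊗ preserves joins in each argument (the half of distributivity that
  -- needs residuation).
  ⋁⊗-least : ∀ {J : Set i} (f : J → Carrier) x y → (∀ j → f j ⊗ x ≤ y) → ⋁ f ⊗ x ≤ y
  ⋁⊗-least f x y h =
    Equivalence.from (residuation (⋁ f) x y)
      (⋁-least f (x ⇒ y) (λ j → Equivalence.to (residuation (f j) x y) (h j)))

  ⊗⋁-least : ∀ {J : Set i} (f : J → Carrier) x y → (∀ j → x ⊗ f j ≤ y) → x ⊗ ⋁ f ≤ y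
  ⊗⋁-least f x y h = begin
    x ⊗ ⋁ f  ≈⟨ comm x (⋁ f) ⟩
    ⋁ f ⊗ x  ≤⟨ ⋁⊗-least f x y (λ j → ≤-trans (≤-reflexive (comm (f j) x)) (h j)) ⟩
    y        ∎

  ⋁-reindex : ∀ {J K : Set i} (r : K → J) (s : J → K) → (∀ j → r (s j) ≡ j)
            → (f : J → Carrier) → ⋁ (λ k → f (r k)) ≈ ⋁ f
  ⋁-reindex r s retract f = antisym
    (⋁-least _ _ (λ k → ⋁-upper f (r k)))
    (⋁-least _ _ (λ j → ≤-⋁ (λ k → f (r k)) (s j)
      (≤-reflexive (Eq.reflexive (cong f (sym (retract j)))))))

module RelationAlgebra {c ℓ i : Level} (L : CompleteResiduatedLattice c ℓ i) where
  open CompleteResiduatedLattice L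
  open FuzzyRelations L
  open LatticeFacts L
  open IsCommutativeMonoid ⊗-isCommutativeMonoid using (assoc)
  open PosetReasoning poset

  ⊆-poset : (A B : Set i) → Poset _ _ _
  ⊆-poset A B = record
    { Carrier = FRel A B
    ; _≈_ = _≐_
    ; _≤_ = _⊆_
    ; isPartialOrder = record
      { isPreorder = record
        { isEquivalence = record
          { refl  = λ _ _ → Eq.refl
          ; sym   = λ p a b → Eq.sym (p a b)
          ; trans = λ p q a b → Eq.trans (p a b) (q a b) }
        ; reflexive = λ p a b → ≤-reflexive (p a b)
        ; trans     = λ p q a b → ≤-trans (p a b) (q a b) }
      ; antisym = λ p q a b → antisym (p a b) (q a b) } }

  module ⊆-Reasoning {A B : Set i} = PosetReasoning (⊆-poset A B)

  ⊆-reflexive : ∀ {A B : Set i} {R S : FRel A B} → R ≐ S → R ⊆ S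
  ⊆-reflexive = Poset.reflexive (⊆-poset _ _)

  ⊆-antisym : ∀ {A B : Set i} {R S : FRel A B} → R ⊆ S → S ⊆ R → R ≐ S
  ⊆-antisym = Poset.antisym (⊆-poset _ _)

  ∘-mono : ∀ {X Y Z : Set i} {R R′ : FRel X Y} {S S′ : FRel Y Z}
         → R ⊆ R′ → S ⊆ S′ → R ∘ S ⊆ R′ ∘ S′
  ∘-mono {R′ = R′} {S′ = S′} R⊆R′ S⊆S′ x z =
    ⋁-least _ _ (λ y → ≤-⋁ (λ y → R′ x y ⊗ S′ y z) y (⊗-mono (R⊆R′ x y) (S⊆S′ y z)))

  ∘-monoˡ : ∀ {X Y Z : Set i} {R R′ : FRel X Y} {S : FRel Y Z} → R ⊆ R′ → R ∘ S ⊆ R′ ∘ S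
  ∘-monoˡ R⊆R′ = ∘-mono R⊆R′ (λ _ _ → ≤-refl)

  ∘-monoʳ : ∀ {X Y Z : Set i} {R : FRel X Y} {S S′ : FRel Y Z} → S ⊆ S′ → R ∘ S ⊆ R ∘ S′
  ∘-monoʳ S⊆S′ = ∘-mono (λ _ _ → ≤-refl) S⊆S′

  -- Composition is associative: both sides are the join of
  -- R(a,b) ⊗ S(b,c) ⊗ T(c,d) over all b and c.
  ∘-assoc : ∀ {W X Y Z : Set i} (R : FRel W X) (S : FRel X Y) (T : FRel Y Z)
          → (R ∘ S) ∘ T ≐ R ∘ (S ∘ T)
  ∘-assoc R S T a d = antisym
    (⋁-least _ _ (λ y → ⋁⊗-least _ _ _ (λ x → begin
      (R a x ⊗ S x y) ⊗ T y d  ≈⟨ assoc (R a x) (S x y) (T y d) ⟩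
      R a x ⊗ (S x y ⊗ T y d)  ≤⟨ ⊗-monoʳ (R a x) (⋁-upper (λ y → S x y ⊗ T y d) y) ⟩
      R a x ⊗ (S ∘ T) x d      ≤⟨ ⋁-upper (λ x → R a x ⊗ (S ∘ T) x d) x ⟩
      (R ∘ (S ∘ T)) a d        ∎)))
    (⋁-least _ _ (λ x → ⊗⋁-least _ _ _ (λ y → begin
      R a x ⊗ (S x y ⊗ T y d)  ≈⟨ assoc (R a x) (S x y) (T y d) ⟨
      (R a x ⊗ S x y) ⊗ T y d  ≤⟨ ⊗-monoˡ (T y d) (⋁-upper (λ x → R a x ⊗ S x y) x) ⟩
      (R ∘ S) a y ⊗ T y d      ≤⟨ ⋁-upper (λ y → (R ∘ S) a y ⊗ T y d) y ⟩
      ((R ∘ S) ∘ T) a d        ∎)))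

  ∘-inflateʳ : ∀ {X Y : Set i} {D : FRel Y Y} → (∀ y → 1L ≤ D y y)
             → (R : FRel X Y) → R ⊆ R ∘ D
  ∘-inflateʳ {D = D} 1≤D R x y = ≤-⋁ (λ y′ → R x y′ ⊗ D y′ y) y (⊗-inflateʳ (R x y) (1≤D y))

  ∘-inflateˡ : ∀ {X Y : Set i} {D : FRel X X} → (∀ x → 1L ≤ D x x)
             → (R : FRel X Y) → R ⊆ D ∘ R
  ∘-inflateˡ {D = D} 1≤D R x y = ≤-⋁ (λ x′ → D x x′ ⊗ R x′ y) x (⊗-inflateˡ (R x y) (1≤D x))

module EquivalenceFacts {c ℓ i : Level} (L : CompleteResiduatedLattice c ℓ i)
  {A : Set i} {E : FuzzyRelations.FRel L A A} (isEquiv : FuzzyRelations.IsFuzzyEquivalence L E) where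
  open CompleteResiduatedLattice L
  open FuzzyRelations L
  open LatticeFacts L
  open RelationAlgebra L
  open IsFuzzyEquivalence isEquiv

  E-diagonal : ∀ a → 1L ≤ E a a
  E-diagonal a = ≤-reflexive (Eq.sym (reflexive a))

  E∘E⊆E : E ∘ E ⊆ E
  E∘E⊆E a c′ = ⋁-least _ _ (λ b → transitive a b c′)

  E⁻¹⊆E : E ⁻¹ ⊆ E
  E⁻¹⊆E a b = ≤-reflexive (symmetric b a)

  E⊆E⁻¹ : E ⊆ E ⁻¹
  E⊆E⁻¹ a b = ≤-reflexive (symmetric a b)

  saturation : FRel A A → FRel A A
  saturation V = E ∘ V ∘ E

  saturation-absorbˡ : (V : FRel A A) → E ∘ saturation V ≐ saturation V
  saturation-absorbˡ V = ⊆-antisym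
    (begin
      E ∘ ((E ∘ V) ∘ E)  ≈⟨ ∘-assoc E (E ∘ V) E ⟨
      (E ∘ (E ∘ V)) ∘ E  ≤⟨ ∘-monoˡ (⊆-reflexive (λ a b → Eq.sym (∘-assoc E E V a b))) ⟩
      ((E ∘ E) ∘ V) ∘ E  ≤⟨ ∘-monoˡ (∘-monoˡ E∘E⊆E) ⟩
      (E ∘ V) ∘ E        ∎)
    (∘-inflateˡ E-diagonal (saturation V))
    where open ⊆-Reasoning

  ∘E⊆saturation : (V : FRel A A) → V ∘ E ⊆ saturation V
  ∘E⊆saturation V = ∘-monoˡ (∘-inflateˡ E-diagonal V)

  E⁻¹∘⊆saturation : (V : FRel A A) → E ⁻¹ ∘ V ⊆ saturation V
  E⁻¹∘⊆saturation V = begin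
    E ⁻¹ ∘ V     ≤⟨ ∘-monoˡ E⁻¹⊆E ⟩
    E ∘ V        ≤⟨ ∘-inflateʳ E-diagonal (E ∘ V) ⟩
    saturation V ∎
    where open ⊆-Reasoning

  ∘-commutes⇔saturation⊆ : (V : FRel A A) → (E ∘ V ⊆ V ∘ E) ⇔ (saturation V ⊆ V ∘ E)
  ∘-commutes⇔saturation⊆ V = mk⇔
    (λ EV⊆VE → begin
      (E ∘ V) ∘ E  ≤⟨ ∘-monoˡ EV⊆VE ⟩
      (V ∘ E) ∘ E  ≈⟨ ∘-assoc V E E ⟩
      V ∘ (E ∘ E)  ≤⟨ ∘-monoʳ E∘E⊆E ⟩
      V ∘ E        ∎)
    (λ sat⊆VE → begin
      E ∘ V         ≤⟨ ∘-inflateʳ E-diagonal (E ∘ V) ⟩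
      saturation V  ≤⟨ sat⊆VE ⟩
      V ∘ E         ∎)
    where open ⊆-Reasoning

  -- Given the lower bound above, an upper bound is the same as equality.
  saturation⊆⇔≐ : (V : FRel A A) → (saturation V ⊆ V ∘ E) ⇔ (V ∘ E ≐ saturation V)
  saturation⊆⇔≐ V = mk⇔ (⊆-antisym (∘E⊆saturation V)) (λ eq → ⊆-reflexive (λ a b → Eq.sym (eq a b)))

  commutes⇒commutes⁻¹ : (V : FRel A A) → E ∘ V ⊆ V ∘ E → E ⁻¹ ∘ V ⊆ V ∘ E ⁻¹
  commutes⇒commutes⁻¹ V EV⊆VE = begin
    E ⁻¹ ∘ V  ≤⟨ ∘-monoˡ E⁻¹⊆E ⟩
    E ∘ V     ≤⟨ EV⊆VE ⟩
    V ∘ E     ≤⟨ ∘-monoʳ E⊆E⁻¹ ⟩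
    V ∘ E ⁻¹  ∎
    where open ⊆-Reasoning

module QuotientTransfer {c ℓ i : Level} (L : CompleteResiduatedLattice c ℓ i)
  {A : Set i} {E : FuzzyRelations.FRel L A A} (isEquiv : FuzzyRelations.IsFuzzyEquivalence L E) where
  open CompleteResiduatedLattice L
  open FuzzyRelations L
  open LatticeFacts L
  open RelationAlgebra L
  open EquivalenceFacts L isEquiv

  -- A composite through A/E is the composite through the representatives,
  -- because every class is E_a for some a.
  ∘-via-representatives : ∀ {X Y : Set i} (R : FRel X (Quot E)) (S : FRel (Quot E) Y)
                        → R ∘ S ≐ (λ x a → R x [ a ]) ∘ (λ a y → S [ a ] y)
  ∘-via-representatives R S x y = Eq.sym (⋁-reindex [_] rep (λ _ → refl) (λ q → R x q ⊗ S q y))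

  natural-∘-quotRel : (V : FRel A A) → ∀ a q → (natural E ∘ quotRel E V) a q ≈ saturation V a (rep q)
  natural-∘-quotRel V a q =
    Eq.trans (∘-via-representatives (natural E) (quotRel E V) a q) (saturation-absorbˡ V a (rep q))

  saturation⊆quotRel-∘-natural⁻¹ : (V : FRel A A)
    → ∀ q a → saturation V (rep q) a ≤ (quotRel E V ∘ natural E ⁻¹) q a
  saturation⊆quotRel-∘-natural⁻¹ V q a = ≤-trans
    (∘-inflateʳ {D = E ⁻¹} E-diagonal (saturation V) (rep q) a)
    (≤-reflexive (Eq.sym (∘-via-representatives (quotRel E V) (natural E ⁻¹) q a)))

  natural⁻¹-∘⊆ : (V : FRel A A) → natural E ⁻¹ ∘ V ⊆ quotRel E V ∘ natural E ⁻¹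
  natural⁻¹-∘⊆ V q a = ≤-trans (E⁻¹∘⊆saturation V (rep q) a) (saturation⊆quotRel-∘-natural⁻¹ V q a)

  -- The second half of WL^{2-3}, and WL^{2-5}, transferred to relations on A;
  -- note that (V ∘ E♮)(a , E_b) is (V ∘ E)(a , b) by definition.
  natural-∘⊆⇔ : (V : FRel A A)
    → (natural E ∘ quotRel E V ⊆ V ∘ natural E) ⇔ (saturation V ⊆ V ∘ E)
  natural-∘⊆⇔ V = mk⇔
    (λ h a b → ≤-trans (≤-reflexive (Eq.sym (natural-∘-quotRel V a [ b ]))) (h a [ b ]))
    (λ h a q → ≤-trans (≤-reflexive (natural-∘-quotRel V a q)) (h a (rep q)))

  natural-∘≐⇔ : (V : FRel A A)
    → (V ∘ natural E ≐ natural E ∘ quotRel E V) ⇔ (V ∘ E ≐ saturation V)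
  natural-∘≐⇔ V = mk⇔
    (λ h a b → Eq.trans (h a [ b ]) (natural-∘-quotRel V a [ b ]))
    (λ h a q → Eq.trans (h a (rep q)) (Eq.sym (natural-∘-quotRel V a q)))

module Characterisations {c ℓ i : Level} (L : CompleteResiduatedLattice c ℓ i)
  {A I : Set i} (V : I → FuzzyRelations.FRel L A A)
  {E : FuzzyRelations.FRel L A A} (isEquiv : FuzzyRelations.IsFuzzyEquivalence L E) where
  open FuzzyRelations L
  open EquivalenceFacts L isEquiv
  open QuotientTransfer L isEquiv

  WL14⇔ : WL14 V E ⇔ (∀ j → E ∘ V j ⊆ V j ∘ E)
  WL14⇔ = mk⇔ (λ w j → proj₁ (w j)) (λ h j → h j , commutes⇒commutes⁻¹ (V j) (h j))

  WL23⇔ : WL23 V (λ j → quotRel E (V j)) (natural E) ⇔ (∀ j → saturation (V j) ⊆ V j ∘ E)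
  WL23⇔ = mk⇔
    (λ w j → Equivalence.to (natural-∘⊆⇔ (V j)) (proj₂ (w j)))
    (λ h j → natural⁻¹-∘⊆ (V j) , Equivalence.from (natural-∘⊆⇔ (V j)) (h j))

  WL25⇔ : WL25 V (λ j → quotRel E (V j)) (natural E) ⇔ (∀ j → V j ∘ E ≐ saturation (V j))
  WL25⇔ = ∀-⇔ (λ j → natural-∘≐⇔ (V j))

theorem6p2 : {c ℓ i : Level} (L : CompleteResiduatedLattice c ℓ i)
    → let open FuzzyRelations L in
    (A : Set i) (I : Set i) → A → I
    → (V : I → FRel A A) (E : FRel A A) → IsFuzzyEquivalence E
    → (WL14 V E ⇔ WL23 V (λ j → quotRel E (V j)) (natural E))
    × (WL23 V (λ j → quotRel E (V j)) (natural E) ⇔ WL25 V (λ j → quotRel E (V j)) (natural E))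
theorem6p2 L A I _ _ V E isEquiv =
    ⇔-sym WL23⇔ ⇔-∘ (∀-⇔ (λ j → ∘-commutes⇔saturation⊆ (V j)) ⇔-∘ WL14⇔)
  , ⇔-sym WL25⇔ ⇔-∘ (∀-⇔ (λ j → saturation⊆⇔≐ (V j)) ⇔-∘ WL23⇔)
  where
    open EquivalenceFacts L isEquiv
    open Characterisations L V isEquiv
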